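{- For any graph $G$, $dom^+_{maj}(G)\leq \gamma_{maj}(G)$.
   Context: Graphs are finite, without loops or multiple edges. For a graph $G=(V,E)$, $N[v]$ denotes the closed neighborhood of $v$; for $f:V\to\{ -1,1\}$ and $X\subseteq V$, $f(X)=\sum_{v\in X}f(v)$. A majority dominating function of $G$ is $f:V\to\{ -1,1\}$ with $|\{v\in V: f(N[v])\geq1\}|\geq|V|/2$; its weight is $f(V)$; $\gamma_{maj}(G)$ is the minimum weight of a majority dominating function of $G$. For a digraph $D=(V,A)$, $N^+[u]=\{u\}\cup\{v: uv\in A\}$; a majority out-dominating function (MODF) of $D$ is $f:V\to\{ -1,1\}$ with $|\{v: f(N^+[v])\geq1\}|\geq|V|/2$, and $\gamma^+_{maj}(D)$ is the minimum weight $f(V)$ of a MODF. An orientation of $G$ is a digraph obtained by replacing each edge $uv$ by exactly one of the arcs $uv$, $vu$. $dom^+_{maj}(G)$ is the minimum of $\gamma^+_{maj}(D)$ over all orientations $D$ of $G$. -}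

module Defs where

open import Data.Nat using (ℕ; _≤_; _*_)
open import Data.Integer using (ℤ; +_; -[1+_]) renaming (_+_ to _+ℤ_; _≤_ to _≤ℤ_)
open import Data.Fin using (Fin)
open import Data.Bool using (Bool; true; false; _∨_; _∧_; if_then_else_)
open import Data.List using (List; filter; length; map; foldr)
open import Data.List.Base using (allFin)
open import Data.Product using (Σ; _×_; ∃)
open import Data.Sum using (_⊎_)
open import Relation.Binary.PropositionalEquality using (_≡_; _≢_)
open import Relation.Nullary using (¬_)
open import Relation.Nullary.Decidable using (Dec; yes; no)
open import Data.Integer.Properties using (_≤?_)

record Graph (n : ℕ) : Set where
  field
    adj   : Fin n → Fin n → Bool
    irrefl : ∀ v → adj v v ≡ false
    sym   : ∀ u v → adj u v ≡ adj v u
open Graph public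

Digraph : ℕ → Set
Digraph n = Fin n → Fin n → Bool

IsOrientation : ∀ {n} → Graph n → Digraph n → Set
IsOrientation {n} G D =
  (∀ u v → D u v ≡ true → adj G u v ≡ true) ×
  (∀ u v → adj G u v ≡ true → (D u v ≡ true × D v u ≡ false) ⊎ (D u v ≡ false × D v u ≡ true))

-- Functions f : V → {-1,1}; true means +1, false means -1.
SignFun : ℕ → Set
SignFun n = Fin n → Bool

val : Bool → ℤ
val true  = + 1
val false = -[1+ 0 ]

sumOver : ∀ {n} → (Fin n → Bool) → SignFun n → ℤ
sumOver {n} X f = foldr (λ v acc → (if X v then val (f v) else + 0) +ℤ acc) (+ 0) (allFin n)

weight : ∀ {n} → SignFun n → ℤ
weight {n} f = sumOver (λ _ → true) f

eqFin : ∀ {n} → Fin n → Fin n → Bool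
eqFin u v with u Data.Fin.≟ v
... | yes _ = true
... | no _  = false

closedN : ∀ {n} → Graph n → Fin n → Fin n → Bool
closedN G v w = eqFin v w ∨ adj G v w

closedOutN : ∀ {n} → Digraph n → Fin n → Fin n → Bool
closedOutN D v w = eqFin v w ∨ D v w

atLeastOne : ℤ → Bool
atLeastOne x with + 1 ≤? x
... | yes _ = true
... | no _  = false

goodCount : ∀ {n} → (Fin n → Fin n → Bool) → SignFun n → ℕ
goodCount {n} N f = length (filter (λ v → atLeastOne (sumOver (N v) f) Data.Bool.≟ true) (allFin n))

-- |{v : f(N[v]) ≥ 1}| ≥ |V|/2, written as 2·count ≥ |V|
IsMDF : ∀ {n} → Graph n → SignFun n → Set
IsMDF {n} G f = n ≤ 2 * goodCount (closedN G) f

IsMODF : ∀ {n} → Digraph n → SignFun n → Set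
IsMODF {n} D f = n ≤ 2 * goodCount (closedOutN D) f

IsGammaMaj : ∀ {n} → Graph n → ℤ → Set
IsGammaMaj {n} G k =
  (∃ λ (f : SignFun n) → IsMDF G f × weight f ≡ k) ×
  (∀ (f : SignFun n) → IsMDF G f → k ≤ℤ weight f)

IsGammaOutMaj : ∀ {n} → Digraph n → ℤ → Set
IsGammaOutMaj {n} D k =
  (∃ λ (f : SignFun n) → IsMODF D f × weight f ≡ k) ×
  (∀ (f : SignFun n) → IsMODF D f → k ≤ℤ weight f)

IsDomOutMaj : ∀ {n} → Graph n → ℤ → Set
IsDomOutMaj {n} G k =
  (∃ λ (D : Digraph n) → IsOrientation G D × IsGammaOutMaj D k) ×
  (∀ (D : Digraph n) (j : ℤ) → IsOrientation G D → IsGammaOutMaj D j → k ≤ℤ j)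

module Submission where

-- Let f be a minimum majority dominating function of G.  Orient G by f:
-- an edge between a (−1)-vertex and a (+1)-vertex points towards the
-- (+1)-vertex, an edge between vertices of equal sign points towards the
-- later vertex in the order of Fin n.  Every vertex v with f(N[v]) ≥ 1
-- then still has f(N⁺[v]) ≥ 1:
--   * if f(v) = −1, N⁺[v] keeps every (+1)-vertex of N[v] and only drops
--     (−1)-vertices, so f(N⁺[v]) ≥ f(N[v]);
--   * if f(v) = +1, N⁺[v] consists of v and (+1)-vertices only.
-- Hence f is a majority out-dominating function of this orientation D,
-- so γ⁺_maj(D) ≤ f(V) = γ_maj(G), and dom⁺_maj(G) ≤ γ⁺_maj(D).

open import Defs hiding (sym)
open import Data.Nat as ℕ using (ℕ; zero; suc)
import Data.Nat.Properties as ℕ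
open import Data.Integer using (ℤ; _≤_; +_; _+_; +≤+; -≤+)
open import Data.Integer.Properties
  using (≤-refl; ≤-trans; ≤-reflexive; ≤-antisym; +-mono-≤; +-monoˡ-≤; +-monoʳ-≤;
         +-identityˡ; +-identityʳ; _≤?_; ≤-totalOrder; module ≤-Reasoning)
open import Data.Fin as Fin using (Fin; _<?_)
open import Data.Fin.Properties using (<-cmp)
open import Data.Bool using (Bool; true; false; _∧_; not; if_then_else_)
open import Data.Bool.Properties using (∧-identityʳ)
import Data.Bool as Bool
open import Data.List using (List; []; _∷_; _++_; map; filter; length; foldr; allFin)
open import Data.List.Membership.Propositional using (_∈_)
open import Data.List.Membership.Propositional.Properties
  using (∈-allFin; ∈-filter⁺; ∈-map⁺; ∈-++⁺ˡ; ∈-++⁺ʳ)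
open import Data.List.Relation.Unary.Any using (here; there)
import Data.List.Relation.Unary.All as All
open import Data.List.Relation.Unary.All.Properties using (all-filter)
open import Data.List.Relation.Binary.Sublist.Propositional using (⊆-refl)
open import Data.List.Relation.Binary.Sublist.Propositional.Properties
  using (filter⁺; length-mono-≤)
open import Data.List.Extrema ≤-totalOrder using (argmin; argmin-all; f[argmin]≤f[xs])
open import Data.Vec.Functional using () renaming (_∷_ to _◂_)
open import Data.Product using (∃; _×_; _,_)
open import Data.Sum using (_⊎_; inj₁; inj₂)
open import Relation.Binary using (tri<; tri≈; tri>)
open import Relation.Binary.PropositionalEquality
  using (_≡_; _≢_; _≗_; refl; sym; trans; cong; cong₂; subst; module ≡-Reasoning)
open import Relation.Nullary using (does; yes; no; contradiction)
open import Relation.Nullary.Decidable using (dec-true; dec-false)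
open import Relation.Unary using (Decidable)

-- The sum Σ_{x ∈ xs} t(x), in exactly the shape used by 'sumOver'.
sumList : ∀ {A : Set} → List A → (A → ℤ) → ℤ
sumList xs t = foldr (λ x acc → t x + acc) (+ 0) xs

sumList-mono : ∀ {A : Set} (xs : List A) {s t : A → ℤ} →
  (∀ x → s x ≤ t x) → sumList xs s ≤ sumList xs t
sumList-mono []       s≤t = ≤-refl
sumList-mono (x ∷ xs) s≤t = +-mono-≤ (s≤t x) (sumList-mono xs s≤t)

sumList-cong : ∀ {A : Set} (xs : List A) {s t : A → ℤ} →
  s ≗ t → sumList xs s ≡ sumList xs t
sumList-cong xs s≗t =
  ≤-antisym (sumList-mono xs (λ x → ≤-reflexive (s≗t x)))
            (sumList-mono xs (λ x → ≤-reflexive (sym (s≗t x))))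

sumList-nonneg : ∀ {A : Set} (xs : List A) {t : A → ℤ} →
  (∀ y → + 0 ≤ t y) → + 0 ≤ sumList xs t
sumList-nonneg []       t≥0 = ≤-refl
sumList-nonneg (x ∷ xs) t≥0 = +-mono-≤ (t≥0 x) (sumList-nonneg xs t≥0)

sumList-member : ∀ {A : Set} {xs : List A} {t : A → ℤ} {x : A} →
  (∀ y → + 0 ≤ t y) → x ∈ xs → t x ≤ sumList xs t
sumList-member {xs = x ∷ xs} {t} t≥0 (here refl) = begin
  t x                    ≡⟨ sym (+-identityʳ (t x)) ⟩
  t x + + 0              ≤⟨ +-monoʳ-≤ (t x) (sumList-nonneg xs t≥0) ⟩
  t x + sumList xs t     ∎
  where open ≤-Reasoning
sumList-member {xs = y ∷ xs} {t} {x} t≥0 (there x∈xs) = begin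
  t x                    ≤⟨ sumList-member t≥0 x∈xs ⟩
  sumList xs t           ≡⟨ sym (+-identityˡ (sumList xs t)) ⟩
  + 0 + sumList xs t     ≤⟨ +-monoˡ-≤ (sumList xs t) (t≥0 y) ⟩
  t y + sumList xs t     ∎
  where open ≤-Reasoning

term : Bool → Bool → ℤ
term inX s = if inX then val s else + 0

term-nonneg : ∀ inX s → (inX ≡ true → s ≡ true) → + 0 ≤ term inX s
term-nonneg false s     _   = ≤-refl
term-nonneg true  true  _   = +≤+ ℕ.z≤n
term-nonneg true  false pos = contradiction (pos refl) (λ ())

term-shift : ∀ s x y → (s ≡ true → x ≡ true → y ≡ true) →
  (s ≡ false → y ≡ true → x ≡ true) → term x s ≤ term y s
term-shift true  false false _    _    = ≤-refl
term-shift true  false true  _    _    = +≤+ ℕ.z≤n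
term-shift true  true  true  _    _    = ≤-refl
term-shift true  true  false gain _    = contradiction (gain refl refl) (λ ())
term-shift false false false _    _    = ≤-refl
term-shift false true  false _    _    = -≤+
term-shift false true  true  _    _    = ≤-refl
term-shift false false true  _    lose = contradiction (lose refl refl) (λ ())

sumOver-shift : ∀ {n} (X Y : Fin n → Bool) (f : SignFun n) →
  (∀ w → f w ≡ true  → X w ≡ true → Y w ≡ true) →
  (∀ w → f w ≡ false → Y w ≡ true → X w ≡ true) →
  sumOver X f ≤ sumOver Y f
sumOver-shift {n} X Y f gain lose =
  sumList-mono (allFin n) (λ w → term-shift (f w) (X w) (Y w) (gain w) (lose w))

sumOver-positive : ∀ {n} (X : Fin n → Bool) (f : SignFun n) {v : Fin n} →
  X v ≡ true → f v ≡ true → (∀ w → X w ≡ true → f w ≡ true) →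
  + 1 ≤ sumOver X f
sumOver-positive X f {v} Xv fv onlyPositive = begin
  + 1                     ≡⟨ cong₂ term (sym Xv) (sym fv) ⟩
  term (X v) (f v)        ≤⟨ sumList-member nonneg (∈-allFin v) ⟩
  sumOver X f             ∎
  where
    open ≤-Reasoning
    nonneg : ∀ w → + 0 ≤ term (X w) (f w)
    nonneg w = term-nonneg (X w) (f w) (onlyPositive w)

sumOver-cong : ∀ {n} (X : Fin n → Bool) {f f′ : SignFun n} →
  f ≗ f′ → sumOver X f ≡ sumOver X f′
sumOver-cong {n} X f≗f′ = sumList-cong (allFin n) (λ w → cong (term (X w)) (f≗f′ w))

atLeastOne-sound : ∀ x → atLeastOne x ≡ true → + 1 ≤ x
atLeastOne-sound x holds with + 1 ≤? x
... | yes 1≤x = 1≤x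
atLeastOne-sound x () | no _

atLeastOne-complete : ∀ x → + 1 ≤ x → atLeastOne x ≡ true
atLeastOne-complete x 1≤x with + 1 ≤? x
... | yes _   = refl
... | no  1≰x = contradiction 1≤x 1≰x

atLeastOne-mono : ∀ {x y} → x ≤ y → atLeastOne x ≡ true → atLeastOne y ≡ true
atLeastOne-mono {x} {y} x≤y holds =
  atLeastOne-complete y (≤-trans (atLeastOne-sound x holds) x≤y)

count-mono : ∀ {A : Set} (p q : A → Bool) (xs : List A) →
  (∀ x → p x ≡ true → q x ≡ true) →
  length (filter (λ x → p x Bool.≟ true) xs) ℕ.≤ length (filter (λ x → q x Bool.≟ true) xs)
count-mono p q xs p⇒q = length-mono-≤
  (filter⁺ (λ x → p x Bool.≟ true) (λ x → q x Bool.≟ true) (λ { refl → p⇒q _ }) (⊆-refl {x = xs}))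

majority-transfer : ∀ {n} (N N′ : Fin n → Fin n → Bool) (f f′ : SignFun n) →
  (∀ v → atLeastOne (sumOver (N v) f) ≡ true → atLeastOne (sumOver (N′ v) f′) ≡ true) →
  n ℕ.≤ 2 ℕ.* goodCount N f → n ℕ.≤ 2 ℕ.* goodCount N′ f′
majority-transfer {n} N N′ f f′ good⇒good majority =
  ℕ.≤-trans majority (ℕ.*-monoʳ-≤ 2 (count-mono _ _ (allFin n) good⇒good))

∧-trueˡ : ∀ {a b} → a ∧ b ≡ true → a ≡ true
∧-trueˡ {true} _ = refl

∧-trueʳ : ∀ {a b} → a ∧ b ≡ true → b ≡ true
∧-trueʳ {true} b≡true = b≡true

complementary : ∀ x {y} → y ≡ not x →
  (x ≡ true × y ≡ false) ⊎ (x ≡ false × y ≡ true)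
complementary true  refl = inj₁ (refl , refl)
complementary false refl = inj₂ (refl , refl)

eqFin-refl : ∀ {n} (v : Fin n) → eqFin v v ≡ true
eqFin-refl v with v Fin.≟ v
... | yes _   = refl
... | no  v≢v = contradiction refl v≢v

eqFin-sound : ∀ {n} {v w : Fin n} → eqFin v w ≡ true → v ≡ w
eqFin-sound {v = v} {w} same with v Fin.≟ w
... | yes v≡w = v≡w
eqFin-sound {v = v} {w} () | no _

edge-distinct : ∀ {n} (G : Graph n) {u v : Fin n} → adj G u v ≡ true → u ≢ v
edge-distinct G {u} uv refl = contradiction (trans (sym uv) (irrefl G u)) (λ ())

-- Tie-break for edges between equally signed vertices: the order of Fin n.
before : ∀ {n} → Fin n → Fin n → Bool
before u v = does (u <? v)

before-flip : ∀ {n} {u v : Fin n} → u ≢ v → before v u ≡ not (before u v)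
before-flip {u = u} {v} u≢v with <-cmp u v
... | tri< u<v _ v≮u rewrite dec-false (v <? u) v≮u | dec-true (u <? v) u<v = refl
... | tri≈ _ u≡v _   = contradiction u≡v u≢v
... | tri> u≮v _ v<u rewrite dec-true (v <? u) v<u | dec-false (u <? v) u≮v = refl

pointsForward : Bool → Bool → Bool → Bool
pointsForward false true  _ = true
pointsForward true  false _ = false
pointsForward false false t = t
pointsForward true  true  t = t

pointsForward-flip : ∀ a b t → pointsForward b a (not t) ≡ not (pointsForward a b t)
pointsForward-flip false true  _ = refl
pointsForward-flip true  false _ = refl
pointsForward-flip false false _ = refl
pointsForward-flip true  true  _ = refl

pointsForward-positive : ∀ b t → pointsForward true b t ≡ true → b ≡ true
pointsForward-positive true _ _ = refl

orientBy : ∀ {n} → Graph n → SignFun n → Digraph n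
orientBy G f u v = adj G u v ∧ pointsForward (f u) (f v) (before u v)

orientBy-isOrientation : ∀ {n} (G : Graph n) (f : SignFun n) →
  IsOrientation G (orientBy G f)
orientBy-isOrientation G f = (λ u v uv → ∧-trueˡ uv) , oneArcPerEdge
  where
    oneArcPerEdge : ∀ u v → adj G u v ≡ true →
      (orientBy G f u v ≡ true × orientBy G f v u ≡ false) ⊎
      (orientBy G f u v ≡ false × orientBy G f v u ≡ true)
    oneArcPerEdge u v uv = complementary (orientBy G f u v) reversed
      where
        open ≡-Reasoning
        reversed : orientBy G f v u ≡ not (orientBy G f u v)
        reversed = begin
          adj G v u ∧ pointsForward (f v) (f u) (before v u)
            ≡⟨ cong₂ _∧_ (trans (Graph.sym G v u) uv)
                         (cong (pointsForward (f v) (f u)) (before-flip (edge-distinct G uv))) ⟩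
          true ∧ pointsForward (f v) (f u) (not (before u v))
            ≡⟨ pointsForward-flip (f u) (f v) (before u v) ⟩
          not (pointsForward (f u) (f v) (before u v))
            ≡⟨ cong (λ a → not (a ∧ pointsForward (f u) (f v) (before u v))) (sym uv) ⟩
          not (orientBy G f u v) ∎

closedOutN⊆closedN : ∀ {n} (G : Graph n) (D : Digraph n) →
  (∀ u v → D u v ≡ true → adj G u v ≡ true) →
  ∀ v w → closedOutN D v w ≡ true → closedN G v w ≡ true
closedOutN⊆closedN G D arcs⇒edges v w w∈N⁺ with eqFin v w
... | true  = refl
... | false = arcs⇒edges v w w∈N⁺

closedOutN-self : ∀ {n} (D : Digraph n) v → closedOutN D v v ≡ true
closedOutN-self D v rewrite eqFin-refl v = refl

orientBy-keepsPositive : ∀ {n} (G : Graph n) (f : SignFun n) {v w : Fin n} →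
  f v ≡ false → f w ≡ true → closedN G v w ≡ true → closedOutN (orientBy G f) v w ≡ true
orientBy-keepsPositive G f {v} {w} fv fw w∈N
  rewrite fv | fw | ∧-identityʳ (adj G v w) = w∈N

orientBy-positiveOut : ∀ {n} (G : Graph n) (f : SignFun n) {v w : Fin n} →
  f v ≡ true → closedOutN (orientBy G f) v w ≡ true → f w ≡ true
orientBy-positiveOut G f {v} {w} fv w∈N⁺ with eqFin v w in same
... | true  = trans (cong f (sym (eqFin-sound same))) fv
... | false = pointsForward-positive (f w) (before v w)
                (subst (λ a → pointsForward a (f w) (before v w) ≡ true) fv (∧-trueʳ w∈N⁺))

orientBy-keepsGood : ∀ {n} (G : Graph n) (f : SignFun n) (v : Fin n) →
  atLeastOne (sumOver (closedN G v) f) ≡ true →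
  atLeastOne (sumOver (closedOutN (orientBy G f) v) f) ≡ true
orientBy-keepsGood G f v good = bySign (f v) refl
  where
    D = orientBy G f
    bySign : ∀ s → f v ≡ s → atLeastOne (sumOver (closedOutN D v) f) ≡ true
    bySign false fv = atLeastOne-mono
      (sumOver-shift (closedN G v) (closedOutN D v) f
        (λ w fw → orientBy-keepsPositive G f fv fw)
        (λ w _ → closedOutN⊆closedN G D (λ _ _ → ∧-trueˡ) v w))
      good
    bySign true fv = atLeastOne-complete _
      (sumOver-positive (closedOutN D v) f (closedOutN-self D v) fv
        (λ w → orientBy-positiveOut G f fv))

MDF⇒MODF : ∀ {n} (G : Graph n) (f : SignFun n) → IsMDF G f → IsMODF (orientBy G f) f
MDF⇒MODF G f = majority-transfer (closedN G) (closedOutN (orientBy G f)) f f (orientBy-keepsGood G f)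

-- All sign functions on Fin n, as a list (b ◂ g takes value b at 0 and
-- g(i) at i + 1).
signFuns : ∀ n → List (SignFun n)
signFuns zero    = (λ ()) ∷ []
signFuns (suc n) = map (false ◂_) (signFuns n) ++ map (true ◂_) (signFuns n)

signFuns-complete : ∀ {n} (f : SignFun n) → ∃ λ g → g ∈ signFuns n × g ≗ f
signFuns-complete {zero}  f = _ , here refl , (λ ())
signFuns-complete {suc n} f with signFuns-complete (λ i → f (Fin.suc i))
... | g , g∈ , g≗ = (f Fin.zero ◂ g) , extend∈ (f Fin.zero) , agree
  where
    extend∈ : ∀ b → (b ◂ g) ∈ signFuns (suc n)
    extend∈ false = ∈-++⁺ˡ (∈-map⁺ (false ◂_) g∈)
    extend∈ true  = ∈-++⁺ʳ _ (∈-map⁺ (true ◂_) g∈)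
    agree : (f Fin.zero ◂ g) ≗ f
    agree Fin.zero    = refl
    agree (Fin.suc i) = g≗ i

-- A decidable property of sign functions that respects pointwise equality
-- and has a witness has a witness of minimum weight w (for any w respecting
-- pointwise equality): the minimiser of w over the finitely many witnesses.
minimal-witness : ∀ {n} (P : SignFun n → Set) → Decidable P →
  (∀ {f f′} → f ≗ f′ → P f → P f′) →
  (w : SignFun n → ℤ) → (∀ {f f′} → f ≗ f′ → w f ≡ w f′) →
  ∀ f → P f → ∃ λ m → P m × (∀ f′ → P f′ → w m ≤ w f′)
minimal-witness {n} P P? P-resp w w-resp f Pf = m , Pm , m-minimal
  where
    witnesses : List (SignFun n)
    witnesses = filter P? (signFuns n)
    m : SignFun n
    m = argmin w f witnesses
    Pm : P m
    Pm = argmin-all w Pf (all-filter P? (signFuns n))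
    m-minimal : ∀ f′ → P f′ → w m ≤ w f′
    m-minimal f′ Pf′ with signFuns-complete f′
    ... | g , g∈ , g≗f′ = ≤-trans
      (All.lookup (f[argmin]≤f[xs] f witnesses) (∈-filter⁺ P? g∈ (P-resp (λ i → sym (g≗f′ i)) Pf′)))
      (≤-reflexive (w-resp g≗f′))

MODF-resp-≗ : ∀ {n} (D : Digraph n) {f f′ : SignFun n} → f ≗ f′ → IsMODF D f → IsMODF D f′
MODF-resp-≗ D {f} {f′} f≗f′ = majority-transfer (closedOutN D) (closedOutN D) f f′
  (λ v → subst (λ x → atLeastOne x ≡ true) (sumOver-cong (closedOutN D v) f≗f′))

gammaOutMaj-exists : ∀ {n} (D : Digraph n) (f : SignFun n) → IsMODF D f →
  ∃ λ k → IsGammaOutMaj D k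
gammaOutMaj-exists {n} D f f-MODF
  with minimal-witness (IsMODF D) (λ g → n ℕ.≤? 2 ℕ.* goodCount (closedOutN D) g)
         (MODF-resp-≗ D) weight (sumOver-cong (λ _ → true)) f f-MODF
... | m , m-MODF , m-minimal = weight m , (m , m-MODF , refl) , m-minimal

theorem4p10 : ∀ (n : ℕ) (G : Graph n) (d g : ℤ) →
    IsDomOutMaj G d → IsGammaMaj G g → d ≤ g
theorem4p10 n G d g (_ , d-minimal) ((f , f-MDF , wf≡g) , _)
  with gammaOutMaj-exists (orientBy G f) f (MDF⇒MODF G f f-MDF)
... | k , k-isGammaOut@(_ , k-minimal) = begin
  d          ≤⟨ d-minimal (orientBy G f) k (orientBy-isOrientation G f) k-isGammaOut ⟩
  k          ≤⟨ k-minimal f (MDF⇒MODF G f f-MDF) ⟩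
  weight f   ≡⟨ wf≡g ⟩
  g          ∎
  where open ≤-Reasoning
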